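{- Let $\mathcal{I}$ be any Turing ideal, let $A\subseteq\omega^\omega$ be such that $A=\mathcal{B}_{\mathcal{I}}(A)$, and assume that $A$ has the $\mathcal{I}$-Laver property. Then $\mathcal{I}(A)$ does not contain any weakly $\mathcal{I}$-generic real.
   Context: A Turing functional $\Phi$ is $h$-bounded if for all $x$ and $m$, $\Phi(x)(m)\downarrow$ implies $\Phi(x)(m)\le h(m)$. $\mathcal{B}_{\mathcal{I}}$ is the set of Turing functionals in $\mathcal{I}$ (computable relative to some oracle in $\mathcal{I}$) which are $h$-bounded for some $h\in\mathcal{I}$; $\mathcal{B}_{\mathcal{I}}(A)=\{g\in\omega^\omega:\exists\Phi\in\mathcal{B}_{\mathcal{I}}\ \exists f\in A\ g=\Phi(f)\}$. A trace is $F:\omega\to[\omega]^{<\omega}$ with $|F(n)|\le 2^n$ for all $n$; $F$ traces $g$ if $g(n)\in F(n)$ for all $n$. $A$ has the $\mathcal{I}$-Laver property if every $f\in A$ is traced by some trace in $\mathcal{I}$. $\mathcal{I}(A)=\{x:\exists y\in\mathcal{I}\ \exists f\in A\ x\le_T y\oplus f\}$. A real is weakly $\mathcal{I}$-generic if it belongs to no closed nowhere dense set with a code in $\mathcal{I}$. -}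

module Defs where

open import Data.Nat using (ℕ; zero; suc; _+_; _*_; _^_; _≤_; _<_; ⌊_/2⌋; _%_)
open import Data.List using (List; []; _∷_; _++_; [_]; length)
open import Data.Product using (Σ; _×_; _,_; ∃; ∃-syntax)
open import Relation.Binary.PropositionalEquality using (_≡_)
open import Relation.Nullary using (¬_)
open import Function.Bundles using (_⇔_)

Real : Set
Real = ℕ → ℕ

RealSet : Set₁
RealSet = Real → Set

data Code : Set where
  zer  : Code
  succ : Code
  proj : ℕ → Code
  orc  : Code
  comp : Code → List Code → Code
  prec : Code → Code → Code
  mu   : Code → Code

lookupD : List ℕ → ℕ → ℕ
lookupD []       _       = 0
lookupD (x ∷ xs) zero    = x
lookupD (x ∷ xs) (suc i) = lookupD xs i

headD : List ℕ → ℕ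
headD xs = lookupD xs 0

mutual
  data Eval (o : Real) : Code → List ℕ → ℕ → Set where
    ezer  : ∀ {xs} → Eval o zer xs 0
    esucc : ∀ {xs} → Eval o succ xs (suc (headD xs))
    eproj : ∀ {i xs} → Eval o (proj i) xs (lookupD xs i)
    eorc  : ∀ {xs} → Eval o orc xs (o (headD xs))
    ecomp : ∀ {f gs xs ys v} → EvalL o gs xs ys → Eval o f ys v →
            Eval o (comp f gs) xs v
    eprec0 : ∀ {f g xs v} → Eval o f xs v → Eval o (prec f g) (0 ∷ xs) v
    eprecS : ∀ {f g n xs r v} → Eval o (prec f g) (n ∷ xs) r →
             Eval o g (n ∷ r ∷ xs) v → Eval o (prec f g) (suc n ∷ xs) v
    emu   : ∀ {f xs n} → MuFrom o f xs 0 n → Eval o (mu f) xs n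

  data EvalL (o : Real) : List Code → List ℕ → List ℕ → Set where
    enil  : ∀ {xs} → EvalL o [] xs []
    econs : ∀ {g gs xs y ys} → Eval o g xs y → EvalL o gs xs ys →
            EvalL o (g ∷ gs) xs (y ∷ ys)

  data MuFrom (o : Real) (f : Code) (xs : List ℕ) : ℕ → ℕ → Set where
    mstop : ∀ {k} → Eval o f (k ∷ xs) 0 → MuFrom o f xs k k
    mstep : ∀ {k w n} → Eval o f (k ∷ xs) (suc w) → MuFrom o f xs (suc k) n →
            MuFrom o f xs k n

_⊕_ : Real → Real → Real
(y ⊕ x) n with n % 2
... | zero  = y ⌊ n /2⌋
... | suc _ = x ⌊ n /2⌋

_≤T_ : Real → Real → Set
x ≤T y = ∃[ e ] (∀ n → Eval y e [ n ] (x n))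

record TuringIdeal (I : RealSet) : Set where
  field
    nonempty  : ∃[ x ] I x
    downward  : ∀ x y → I y → x ≤T y → I x
    joinClosed : ∀ x y → I x → I y → I (x ⊕ y)

-- Turing functionals relative to an oracle y: Φ(x)(m) ≃ φ_e^{y ⊕ x}(m)

record Functional : Set where
  constructor functional
  field
    param : Real
    code  : Code

_[_]⟨_⟩⇓_ : Functional → Real → ℕ → ℕ → Set
functional y e [ x ]⟨ m ⟩⇓ v = Eval (y ⊕ x) e [ m ] v

_≐_[_] : Real → Functional → Real → Set
g ≐ Φ [ x ] = ∀ m → Φ [ x ]⟨ m ⟩⇓ g m

Bounded : Real → Functional → Set
Bounded h Φ = ∀ x m v → Φ [ x ]⟨ m ⟩⇓ v → v ≤ h m

InB : RealSet → Functional → Set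
InB I Φ = I (Functional.param Φ) × (∃[ h ] (I h × Bounded h Φ))

B⟨_⟩ : RealSet → RealSet → RealSet
B⟨ I ⟩ A g = ∃[ Φ ] (InB I Φ × ∃[ f ] (A f × g ≐ Φ [ f ]))

I⟨_⟩ : RealSet → RealSet → RealSet
I⟨ I ⟩ A x = ∃[ y ] (I y × ∃[ f ] (A f × x ≤T (y ⊕ f)))

-- Traces: F(n) is a finite set given by its canonical index (bit i of
-- F n is 1 iff i ∈ F(n)).

bit : ℕ → ℕ → ℕ
bit k zero    = k % 2
bit k (suc i) = bit ⌊ k /2⌋ i

_∈D_ : ℕ → ℕ → Set
i ∈D k = bit k i ≡ 1

sumBelow : (ℕ → ℕ) → ℕ → ℕ
sumBelow f zero    = 0
sumBelow f (suc n) = sumBelow f n + f n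

-- cardinality of D_k (bits at positions ≥ k are 0)
card : ℕ → ℕ
card k = sumBelow (bit k) k

IsTrace : Real → Set
IsTrace F = ∀ n → card (F n) ≤ 2 ^ n

Traces : Real → Real → Set
Traces F g = ∀ n → g n ∈D F n

LaverProperty : RealSet → RealSet → Set
LaverProperty I A = ∀ f → A f → ∃[ F ] (I F × IsTrace F × Traces F f)

-- Closed sets and their codes.  A code T : ℕ → ℕ determines the closed set
-- [T] = { x | every initial segment x↾n has T(⌜x↾n⌝) = 0 }.

tri : ℕ → ℕ
tri zero    = 0
tri (suc n) = suc n + tri n

pair : ℕ → ℕ → ℕ
pair a b = tri (a + b) + b

⌜_⌝ : List ℕ → ℕ
⌜ [] ⌝     = 0
⌜ a ∷ σ ⌝ = suc (pair a ⌜ σ ⌝)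

_↾_ : Real → ℕ → List ℕ
x ↾ zero  = []
x ↾ suc n = (x ↾ n) ++ [ x n ]

InClosed : Real → Real → Set
InClosed T x = ∀ n → T ⌜ x ↾ n ⌝ ≡ 0

Extends : Real → List ℕ → Set
Extends x σ = x ↾ length σ ≡ σ

NowhereDense : Real → Set
NowhereDense T = ∀ σ → ¬ (∀ x → Extends x σ → InClosed T x)

WeaklyGeneric : RealSet → Real → Set
WeaklyGeneric I x = ∀ T → I T → NowhereDense T → ¬ InClosed T x

-- Since x ≤T y ⊕ f with y ∈ I and f ∈ A, the truncation g m = min (x m) (2 ^ m)
-- is the image of f under a 2^m-bounded functional with parameter y, so
-- g ∈ B_I(A) = A, and the Laver property yields a trace F ∈ I of g.  The closed
-- set of all z with min (z n) (2 ^ n) ∈ F n for every n has a code computable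
-- from F and contains x.  It is nowhere dense: a string σ of length n can be
-- extended by a value v ≤ 2 ^ n outside F n, which exists as |F n| ≤ 2 ^ n.
module Submission where

open import Defs
open import Function.Bundles using (_⇔_; Equivalence)
open import Relation.Nullary using (¬_; yes; no; contradiction)

open import Data.Nat using (ℕ; zero; suc; pred; _+_; _∸_; _^_; _⊓_; _≤_; _<_; z≤n; s≤s; z<s; ⌊_/2⌋; _%_; s≤s⁻¹; _≤?_; _<?_; _≤′_; ≤′-refl; ≤′-step)
open import Data.Nat.Properties
open import Data.Nat.GeneralisedArithmetic using (iterate)
open import Data.Fin using (Fin; zero; suc; toℕ; #_)
open import Data.Vec using (Vec; []; _∷_; lookup; toList)
open import Data.List using ([]; _∷_; _++_; [_]; length; drop; applyUpTo)
open import Data.List.Properties using (length-applyUpTo; applyUpTo-∷ʳ; drop-all; drop-[])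
open import Data.Product using (_×_; _,_; ∃-syntax; proj₁; proj₂)
open import Data.Sum using (_⊎_; inj₁; inj₂)
open import Relation.Binary using (tri<; tri≈; tri>)
open import Relation.Binary.PropositionalEquality using (_≡_; refl; sym; trans; cong; cong₂; subst; subst₂; module ≡-Reasoning)

mutual
  Eval-deterministic : ∀ {o c xs v w} → Eval o c xs v → Eval o c xs w → v ≡ w
  Eval-deterministic ezer ezer = refl
  Eval-deterministic esucc esucc = refl
  Eval-deterministic eproj eproj = refl
  Eval-deterministic eorc eorc = refl
  Eval-deterministic (ecomp gs f) (ecomp gs′ f′) with EvalL-deterministic gs gs′
  ... | refl = Eval-deterministic f f′
  Eval-deterministic (eprec0 f) (eprec0 f′) = Eval-deterministic f f′
  Eval-deterministic (eprecS r g) (eprecS r′ g′) with Eval-deterministic r r′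
  ... | refl = Eval-deterministic g g′
  Eval-deterministic (emu m) (emu m′) = MuFrom-deterministic m m′

  EvalL-deterministic : ∀ {o cs xs vs ws} → EvalL o cs xs vs → EvalL o cs xs ws → vs ≡ ws
  EvalL-deterministic enil enil = refl
  EvalL-deterministic (econs g gs) (econs g′ gs′) =
    cong₂ _∷_ (Eval-deterministic g g′) (EvalL-deterministic gs gs′)

  MuFrom-deterministic : ∀ {o f xs k n m} → MuFrom o f xs k n → MuFrom o f xs k m → n ≡ m
  MuFrom-deterministic (mstop _) (mstop _) = refl
  MuFrom-deterministic (mstop p) (mstep p′ _) with Eval-deterministic p p′
  ... | ()
  MuFrom-deterministic (mstep p _) (mstop p′) with Eval-deterministic p p′
  ... | ()
  MuFrom-deterministic (mstep _ m) (mstep _ m′) = MuFrom-deterministic m m′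

Fn : ℕ → Set
Fn k = Real → Vec ℕ k → ℕ

Computable : (k : ℕ) → Fn k → Set
Computable k F = ∃[ c ] (∀ o xs → Eval o c (toList xs) (F o xs))

Computable₁ : (Real → ℕ → ℕ) → Set
Computable₁ f = Computable 1 λ o xs → f o (lookup xs zero)

Computable₂ : (Real → ℕ → ℕ → ℕ) → Set
Computable₂ f = Computable 2 λ o xs → f o (lookup xs zero) (lookup xs (suc zero))

computable-ext : ∀ {k} {F G : Fn k} → Computable k F → (∀ o xs → F o xs ≡ G o xs) → Computable k G
computable-ext (c , F⇓) F≗G = c , λ o xs → subst (Eval o c (toList xs)) (F≗G o xs) (F⇓ o xs)

computable⇒≤T : ∀ {f} → Computable₁ f → ∀ o → f o ≤T o
computable⇒≤T (c , f⇓) o = c , λ n → f⇓ o (n ∷ [])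

computable∈ideal : ∀ {I h} → TuringIdeal I → Computable₁ (λ _ → h) → I h
computable∈ideal {h = h} ideal hc = downward h z z∈I (computable⇒≤T hc z)
  where
  open TuringIdeal ideal
  z = proj₁ nonempty
  z∈I = proj₂ nonempty

zero-computable : ∀ {k} → Computable k λ _ _ → 0
zero-computable = zer , λ _ _ → ezer

suc-computable : Computable₁ λ _ → suc
suc-computable = succ , λ { _ (_ ∷ []) → esucc }

oracle-computable : Computable₁ λ o → o
oracle-computable = orc , λ { _ (_ ∷ []) → eorc }

lookupD-toList : ∀ {k} (xs : Vec ℕ k) (i : Fin k) → lookupD (toList xs) (toℕ i) ≡ lookup xs i
lookupD-toList (x ∷ xs) zero = refl
lookupD-toList (x ∷ xs) (suc i) = lookupD-toList xs i

proj-computable : ∀ {k} (i : Fin k) → Computable k λ _ xs → lookup xs i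
proj-computable i =
  proj (toℕ i) , λ o xs → subst (Eval o _ (toList xs)) (lookupD-toList xs i) eproj

compose₁ : ∀ {k} {F : Fn 1} {G : Fn k} → Computable 1 F → Computable k G →
           Computable k λ o xs → F o (G o xs ∷ [])
compose₁ {G = G} (cf , f⇓) (cg , g⇓) =
  comp cf (cg ∷ []) , λ o xs → ecomp (econs (g⇓ o xs) enil) (f⇓ o (G o xs ∷ []))

compose₂ : ∀ {k} {F : Fn 2} {G H : Fn k} → Computable 2 F → Computable k G → Computable k H →
           Computable k λ o xs → F o (G o xs ∷ H o xs ∷ [])
compose₂ {G = G} {H} (cf , f⇓) (cg , g⇓) (ch , h⇓) =
  comp cf (cg ∷ ch ∷ []) ,
  λ o xs → ecomp (econs (g⇓ o xs) (econs (h⇓ o xs) enil)) (f⇓ o (G o xs ∷ H o xs ∷ []))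

primrec : ∀ {k} {F : Fn k} {G : Fn (2 + k)} {H : Fn (suc k)} →
          Computable k F → Computable (2 + k) G →
          (∀ o xs → H o (0 ∷ xs) ≡ F o xs) →
          (∀ o n xs → H o (suc n ∷ xs) ≡ G o (n ∷ H o (n ∷ xs) ∷ xs)) →
          Computable (suc k) H
primrec {k} {F} {G} {H} (cf , f⇓) (cg , g⇓) H-zero H-suc =
  prec cf cg , λ { o (n ∷ xs) → go o n xs }
  where
  go : ∀ o n (xs : Vec ℕ k) → Eval o (prec cf cg) (n ∷ toList xs) (H o (n ∷ xs))
  go o zero xs = subst (Eval o _ _) (sym (H-zero o xs)) (eprec0 (f⇓ o xs))
  go o (suc n) xs =
    subst (Eval o _ _) (sym (H-suc o n xs)) (eprecS (go o n xs) (g⇓ o (n ∷ H o (n ∷ xs) ∷ xs)))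

one-computable : ∀ {k} → Computable k λ _ _ → 1
one-computable = compose₁ suc-computable zero-computable

+-computable : Computable₂ λ _ → _+_
+-computable = primrec (proj-computable (# 0)) (compose₁ suc-computable (proj-computable (# 1)))
  (λ _ _ → refl) (λ _ _ _ → refl)

pred-computable : Computable₁ λ _ → pred
pred-computable = primrec zero-computable (proj-computable (# 0)) (λ _ _ → refl) (λ _ _ _ → refl)

∸-computable : Computable₂ λ _ → _∸_
∸-computable = compose₂ flipped (proj-computable (# 1)) (proj-computable (# 0))
  where
  flipped : Computable₂ λ _ n m → m ∸ n
  flipped = primrec (proj-computable (# 0)) (compose₁ pred-computable (proj-computable (# 1)))
    (λ _ _ → refl) (λ { _ n (m ∷ []) → sym (pred[m∸n]≡m∸[1+n] m n) })

m∸[m∸n]≡m⊓n : ∀ m n → m ∸ (m ∸ n) ≡ m ⊓ n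
m∸[m∸n]≡m⊓n m n = begin
  m ∸ (m ∸ n)                 ≡⟨ cong (_∸ (m ∸ n)) (sym (m⊓n+n∸m≡n n m)) ⟩
  n ⊓ m + (m ∸ n) ∸ (m ∸ n)   ≡⟨ m+n∸n≡m (n ⊓ m) (m ∸ n) ⟩
  n ⊓ m                       ≡⟨ ⊓-comm n m ⟩
  m ⊓ n                       ∎
  where open ≡-Reasoning

⊓-computable : Computable₂ λ _ → _⊓_
⊓-computable = computable-ext
  (compose₂ ∸-computable (proj-computable (# 0))
    (compose₂ ∸-computable (proj-computable (# 0)) (proj-computable (# 1))))
  λ { _ (m ∷ n ∷ []) → m∸[m∸n]≡m⊓n m n }

2^-computable : Computable₁ λ _ n → 2 ^ n
2^-computable =
  primrec one-computable (compose₂ +-computable (proj-computable (# 1)) (proj-computable (# 1)))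
  (λ _ _ → refl) (λ _ n _ → cong (2 ^ n +_) (+-identityʳ (2 ^ n)))

tri-computable : Computable₁ λ _ → tri
tri-computable = primrec zero-computable
  (compose₂ +-computable (compose₁ suc-computable (proj-computable (# 0))) (proj-computable (# 1)))
  (λ _ _ → refl) (λ _ _ _ → refl)

iterate-computable : ∀ {f} → Computable₁ (λ _ → f) → Computable₂ λ _ n x → iterate f x n
iterate-computable {f} fc = primrec (proj-computable (# 0)) (compose₁ fc (proj-computable (# 1)))
  (λ _ _ → refl) (λ { _ n (x ∷ []) → iterate-suc x n })
  where
  iterate-suc : ∀ x n → iterate f x (suc n) ≡ f (iterate f x n)
  iterate-suc x zero = refl
  iterate-suc x (suc n) = iterate-suc (f x) n

sumBelow-computable : ∀ {f} → Computable₂ f → Computable₂ λ o n x → sumBelow (λ i → f o i x) n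
sumBelow-computable fc = primrec zero-computable
  (compose₂ +-computable (proj-computable (# 1))
    (compose₂ fc (proj-computable (# 0)) (proj-computable (# 2))))
  (λ _ _ → refl) (λ _ _ _ → refl)

[1+n]%2≡1∸n%2 : ∀ n → suc n % 2 ≡ 1 ∸ n % 2
[1+n]%2≡1∸n%2 zero = refl
[1+n]%2≡1∸n%2 (suc zero) = refl
[1+n]%2≡1∸n%2 (suc (suc n)) = [1+n]%2≡1∸n%2 n

⌊1+n/2⌋≡⌊n/2⌋+n%2 : ∀ n → ⌊ suc n /2⌋ ≡ ⌊ n /2⌋ + n % 2
⌊1+n/2⌋≡⌊n/2⌋+n%2 zero = refl
⌊1+n/2⌋≡⌊n/2⌋+n%2 (suc zero) = refl
⌊1+n/2⌋≡⌊n/2⌋+n%2 (suc (suc n)) = cong suc (⌊1+n/2⌋≡⌊n/2⌋+n%2 n)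

%2-computable : Computable₁ λ _ n → n % 2
%2-computable = primrec zero-computable (compose₂ ∸-computable one-computable (proj-computable (# 1)))
  (λ _ _ → refl) (λ _ n _ → [1+n]%2≡1∸n%2 n)

⌊/2⌋-computable : Computable₁ λ _ → ⌊_/2⌋
⌊/2⌋-computable = primrec zero-computable
  (compose₂ +-computable (proj-computable (# 1)) (compose₁ %2-computable (proj-computable (# 0))))
  (λ _ _ → refl) (λ _ n _ → ⌊1+n/2⌋≡⌊n/2⌋+n%2 n)

bit≡iterate-⌊/2⌋ : ∀ k i → bit k i ≡ iterate ⌊_/2⌋ k i % 2
bit≡iterate-⌊/2⌋ k zero = refl
bit≡iterate-⌊/2⌋ k (suc i) = bit≡iterate-⌊/2⌋ ⌊ k /2⌋ i

bit-computable : Computable₂ λ _ → bit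
bit-computable = computable-ext
  (compose₁ %2-computable
    (compose₂ (iterate-computable ⌊/2⌋-computable) (proj-computable (# 1)) (proj-computable (# 0))))
  λ { _ (k ∷ i ∷ []) → sym (bit≡iterate-⌊/2⌋ k i) }

bit-beyond : ∀ k i → k ≤ i → bit k i ≡ 0
bit-beyond zero zero _ = refl
bit-beyond zero (suc i) _ = bit-beyond 0 i z≤n
bit-beyond (suc k) (suc i) (s≤s k≤i) = bit-beyond ⌊ suc k /2⌋ i (≤-trans (s≤s⁻¹ (⌊n/2⌋<n k)) k≤i)

OnDiagonal : ℕ → ℕ → Set
OnDiagonal d c = tri d ≤ c × c < tri (suc d)

-- 1 ∸ (m ∸ n) is the indicator of m ≤ n: the index steps up when c reaches the next triangular number.
diagonal : ℕ → ℕ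
diagonal zero = 0
diagonal (suc c) = diagonal c + (1 ∸ (tri (suc (diagonal c)) ∸ suc c))

onDiagonal-suc : ∀ {d c} → OnDiagonal d c → OnDiagonal (d + (1 ∸ (tri (suc d) ∸ suc c))) (suc c)
onDiagonal-suc {d} {c} (start≤c , c<end) with tri (suc d) ≤? suc c
... | yes end≤ rewrite m≤n⇒m∸n≡0 end≤ | +-comm d 1 =
  end≤ , ≤-<-trans c<end (m<n+m (tri (suc d)) {suc (suc d)} z<s)
... | no end≰ rewrite m≤n⇒m∸n≡0 (m<n⇒0<n∸m (≰⇒> end≰)) | +-identityʳ d =
  ≤-trans start≤c (n≤1+n c) , ≰⇒> end≰

diagonal-onDiagonal : ∀ c → OnDiagonal (diagonal c) c
diagonal-onDiagonal zero = z≤n , s≤s z≤n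
diagonal-onDiagonal (suc c) = onDiagonal-suc {diagonal c} (diagonal-onDiagonal c)

tri-mono-≤ : ∀ {m n} → m ≤ n → tri m ≤ tri n
tri-mono-≤ z≤n = z≤n
tri-mono-≤ (s≤s m≤n) = +-mono-≤ (s≤s m≤n) (tri-mono-≤ m≤n)

onDiagonal-unique : ∀ {d d′ c} → OnDiagonal d c → OnDiagonal d′ c → d ≡ d′
onDiagonal-unique {d} {d′} (start≤c , c<end) (start′≤c , c<end′) with <-cmp d d′
... | tri< d<d′ _ _ = contradiction (≤-trans (tri-mono-≤ d<d′) start′≤c) (<⇒≱ c<end)
... | tri≈ _ d≡d′ _ = d≡d′
... | tri> _ _ d′<d = contradiction (≤-trans (tri-mono-≤ d′<d) start≤c) (<⇒≱ c<end′)

pair-onDiagonal : ∀ a b → OnDiagonal (a + b) (pair a b)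
pair-onDiagonal a b =
  m≤m+n (tri (a + b)) b ,
  subst (pair a b <_) (+-comm (tri (a + b)) (suc (a + b))) (+-monoʳ-< (tri (a + b)) (s≤s (m≤n+m b a)))

diagonal-pair : ∀ a b → diagonal (pair a b) ≡ a + b
diagonal-pair a b = onDiagonal-unique (diagonal-onDiagonal (pair a b)) (pair-onDiagonal a b)

unpair₁ unpair₂ : ℕ → ℕ
unpair₂ c = c ∸ tri (diagonal c)
unpair₁ c = diagonal c ∸ unpair₂ c

unpair₂-pair : ∀ a b → unpair₂ (pair a b) ≡ b
unpair₂-pair a b rewrite diagonal-pair a b = m+n∸m≡n (tri (a + b)) b

unpair₁-pair : ∀ a b → unpair₁ (pair a b) ≡ a
unpair₁-pair a b rewrite unpair₂-pair a b | diagonal-pair a b = m+n∸n≡m a b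

diagonal-computable : Computable₁ λ _ → diagonal
diagonal-computable = primrec zero-computable
  (compose₂ +-computable (proj-computable (# 1))
    (compose₂ ∸-computable one-computable
      (compose₂ ∸-computable (compose₁ tri-computable (compose₁ suc-computable (proj-computable (# 1))))
                             (compose₁ suc-computable (proj-computable (# 0))))))
  (λ _ _ → refl) (λ _ _ _ → refl)

unpair₂-computable : Computable₁ λ _ → unpair₂
unpair₂-computable = compose₂ ∸-computable (proj-computable (# 0))
  (compose₁ tri-computable (compose₁ diagonal-computable (proj-computable (# 0))))

unpair₁-computable : Computable₁ λ _ → unpair₁
unpair₁-computable = compose₂ ∸-computable (compose₁ diagonal-computable (proj-computable (# 0)))
  (compose₁ unpair₂-computable (proj-computable (# 0)))

hd tl : ℕ → ℕ
hd s = unpair₁ (pred s)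
tl s = unpair₂ (pred s)

hd-⌜∷⌝ : ∀ a τ → hd ⌜ a ∷ τ ⌝ ≡ a
hd-⌜∷⌝ a τ = unpair₁-pair a ⌜ τ ⌝

tl-⌜∷⌝ : ∀ a τ → tl ⌜ a ∷ τ ⌝ ≡ ⌜ τ ⌝
tl-⌜∷⌝ a τ = unpair₂-pair a ⌜ τ ⌝

iterate-tl-⌜⌝ : ∀ σ i → iterate tl ⌜ σ ⌝ i ≡ ⌜ drop i σ ⌝
iterate-tl-⌜⌝ σ zero = refl
iterate-tl-⌜⌝ [] (suc i) = trans (iterate-tl-⌜⌝ [] i) (cong ⌜_⌝ (drop-[] i))
iterate-tl-⌜⌝ (a ∷ σ) (suc i) rewrite tl-⌜∷⌝ a σ = iterate-tl-⌜⌝ σ i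

length≤⌜⌝ : ∀ σ → length σ ≤ ⌜ σ ⌝
length≤⌜⌝ [] = z≤n
length≤⌜⌝ (a ∷ σ) = s≤s (≤-trans (length≤⌜⌝ σ) (m≤n+m ⌜ σ ⌝ (tri (a + ⌜ σ ⌝))))

hd-computable : Computable₁ λ _ → hd
hd-computable = compose₁ unpair₁-computable (compose₁ pred-computable (proj-computable (# 0)))

tl-computable : Computable₁ λ _ → tl
tl-computable = compose₁ unpair₂-computable (compose₁ pred-computable (proj-computable (# 0)))

sumBelow-zero : ∀ {f} → (∀ i → f i ≡ 0) → ∀ n → sumBelow f n ≡ 0
sumBelow-zero f≡0 zero = refl
sumBelow-zero {f} f≡0 (suc n) rewrite sumBelow-zero f≡0 n = f≡0 n

term≤sumBelow : ∀ f {i n} → i < n → f i ≤ sumBelow f n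
term≤sumBelow f {i} {suc n} i<1+n with m≤n⇒m<n∨m≡n (s≤s⁻¹ i<1+n)
... | inj₁ i<n = ≤-trans (term≤sumBelow f i<n) (m≤m+n (sumBelow f n) (f n))
... | inj₂ refl = m≤n+m (f i) (sumBelow f i)

sumBelow-mono-≤ : ∀ f {m n} → m ≤ n → sumBelow f m ≤ sumBelow f n
sumBelow-mono-≤ f m≤n = go (≤⇒≤′ m≤n)
  where
  go : ∀ {m n} → m ≤′ n → sumBelow f m ≤ sumBelow f n
  go ≤′-refl = ≤-refl
  go (≤′-step {n} m≤′n) = ≤-trans (go m≤′n) (m≤m+n (sumBelow f n) (f n))

zero-below⊎n≤sumBelow : ∀ f n → (∃[ i ] (i < n × f i ≡ 0)) ⊎ n ≤ sumBelow f n
zero-below⊎n≤sumBelow f zero = inj₂ z≤n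
zero-below⊎n≤sumBelow f (suc n) with zero-below⊎n≤sumBelow f n | f n in fn≡
... | inj₁ (i , i<n , fi≡0) | _ = inj₁ (i , m<n⇒m<1+n i<n , fi≡0)
... | inj₂ _ | zero = inj₁ (n , ≤-refl , fn≡)
... | inj₂ n≤sum | suc m =
  inj₂ (subst (suc n ≤_) (sym (+-suc (sumBelow f n) m)) (s≤s (≤-trans n≤sum (m≤m+n _ m))))

card≤⇒∃bit≡0 : ∀ k N → card k ≤ N → ∃[ v ] (v ≤ N × bit k v ≡ 0)
card≤⇒∃bit≡0 k N card≤N with k ≤? N
... | yes k≤N = k , k≤N , bit-beyond k k ≤-refl
... | no k≰N with zero-below⊎n≤sumBelow (bit k) (suc N)
...   | inj₁ (v , v<1+N , bit≡0) = v , s≤s⁻¹ v<1+N , bit≡0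
...   | inj₂ 1+N≤sum =
  contradiction (≤-trans 1+N≤sum (≤-trans (sumBelow-mono-≤ (bit k) (≰⇒> k≰N)) card≤N)) (n≮n N)

↾≡applyUpTo : ∀ x n → x ↾ n ≡ applyUpTo x n
↾≡applyUpTo x zero = refl
↾≡applyUpTo x (suc n) = trans (cong (_++ [ x n ]) (↾≡applyUpTo x n)) (applyUpTo-∷ʳ x n)

length-↾ : ∀ x n → length (x ↾ n) ≡ n
length-↾ x n = trans (cong length (↾≡applyUpTo x n)) (length-applyUpTo x n)

drop-applyUpTo : ∀ (f : ℕ → ℕ) {i n} → i < n →
                 drop i (applyUpTo f n) ≡ f i ∷ drop (suc i) (applyUpTo f n)
drop-applyUpTo f {zero} {suc n} _ = refl
drop-applyUpTo f {suc i} {suc n} i<n = drop-applyUpTo (λ k → f (suc k)) (s≤s⁻¹ i<n)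

applyUpTo-lookupD-++ : ∀ σ τ → applyUpTo (lookupD (σ ++ τ)) (length σ) ≡ σ
applyUpTo-lookupD-++ [] τ = refl
applyUpTo-lookupD-++ (a ∷ σ) τ = cong (a ∷_) (applyUpTo-lookupD-++ σ τ)

lookupD-++-length : ∀ σ a τ → lookupD (σ ++ a ∷ τ) (length σ) ≡ a
lookupD-++-length [] a τ = refl
lookupD-++-length (b ∷ σ) a τ = lookupD-++-length σ a τ

-- For t the code of a string, violation F i t is 1 iff the string is nonempty and
-- its head, truncated at 2 ^ i, is not in F i.
violation : Real → ℕ → ℕ → ℕ
violation F i t = (t ⊓ 1) ∸ bit (F i) (hd t ⊓ 2 ^ i)

violation-⌜[]⌝ : ∀ F i → violation F i ⌜ [] ⌝ ≡ 0
violation-⌜[]⌝ F i = 0∸n≡0 (bit (F i) (hd 0 ⊓ 2 ^ i))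

violation-⌜∷⌝ : ∀ F i a τ → violation F i ⌜ a ∷ τ ⌝ ≡ 1 ∸ bit (F i) (a ⊓ 2 ^ i)
violation-⌜∷⌝ F i a τ rewrite ⊓-zeroʳ (pair a ⌜ τ ⌝) | hd-⌜∷⌝ a τ = refl

-- Entry i of the string coded by s heads its i-th tail, and exists only for i < s;
-- so traceCode F codes the closed set {z | ∀ i → bit (F i) (z i ⊓ 2 ^ i) ≡ 1}.
traceCode : Real → Real
traceCode F s = sumBelow (λ i → violation F i (iterate tl s i)) s

violation-↾ : ∀ F x {i n} → i < n →
              violation F i (iterate tl ⌜ x ↾ n ⌝ i) ≡ 1 ∸ bit (F i) (x i ⊓ 2 ^ i)
violation-↾ F x {i} {n} i<n
  rewrite iterate-tl-⌜⌝ (x ↾ n) i | ↾≡applyUpTo x n | drop-applyUpTo x i<n =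
  violation-⌜∷⌝ F i (x i) (drop (suc i) (applyUpTo x n))

violation-↾-beyond : ∀ F x {i n} → n ≤ i → violation F i (iterate tl ⌜ x ↾ n ⌝ i) ≡ 0
violation-↾-beyond F x {i} {n} n≤i
  rewrite iterate-tl-⌜⌝ (x ↾ n) i | drop-all i (x ↾ n) (subst (_≤ i) (sym (length-↾ x n)) n≤i) =
  violation-⌜[]⌝ F i

traceCode-computable : Computable₁ traceCode
traceCode-computable =
  compose₂ (sumBelow-computable {f = violationAt} violationAt-computable)
    (proj-computable (# 0)) (proj-computable (# 0))
  where
  violationAt : Real → ℕ → ℕ → ℕ
  violationAt F i s = violation F i (iterate tl s i)
  violationAt-computable : Computable₂ violationAt
  violationAt-computable =
    compose₂ ∸-computable
      (compose₂ ⊓-computable tail one-computable)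
      (compose₂ bit-computable
        (compose₁ oracle-computable (proj-computable (# 0)))
        (compose₂ ⊓-computable (compose₁ hd-computable tail)
                               (compose₁ 2^-computable (proj-computable (# 0)))))
    where
    tail = compose₂ (iterate-computable tl-computable) (proj-computable (# 0)) (proj-computable (# 1))

traceCode-closed : ∀ {F x} → Traces F (λ m → x m ⊓ 2 ^ m) → InClosed (traceCode F) x
traceCode-closed {F} {x} F-traces n = sumBelow-zero no-violation ⌜ x ↾ n ⌝
  where
  no-violation : ∀ i → violation F i (iterate tl ⌜ x ↾ n ⌝ i) ≡ 0
  no-violation i with i <? n
  ... | yes i<n = trans (violation-↾ F x i<n) (cong (1 ∸_) (F-traces i))
  ... | no i≮n = violation-↾-beyond F x (≮⇒≥ i≮n)

traceCode-nowhereDense : ∀ {F} → IsTrace F → NowhereDense (traceCode F)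
traceCode-nowhereDense {F} F-trace σ all-closed
  with card≤⇒∃bit≡0 (F (length σ)) (2 ^ length σ) (F-trace (length σ))
... | v , v≤2^n , v∉F = contradiction (all-closed x′ x′-extends-σ (suc n)) violated
  where
  n = length σ
  x′ : Real
  x′ = lookupD (σ ++ [ v ])
  x′-extends-σ : Extends x′ σ
  x′-extends-σ = trans (↾≡applyUpTo x′ n) (applyUpTo-lookupD-++ σ [ v ])
  s = ⌜ x′ ↾ suc n ⌝
  violation≡1 : violation F n (iterate tl s n) ≡ 1
  violation≡1 = begin
    violation F n (iterate tl s n)  ≡⟨ violation-↾ F x′ ≤-refl ⟩
    1 ∸ bit (F n) (x′ n ⊓ 2 ^ n)    ≡⟨ cong (λ a → 1 ∸ bit (F n) (a ⊓ 2 ^ n)) (lookupD-++-length σ v []) ⟩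
    1 ∸ bit (F n) (v ⊓ 2 ^ n)       ≡⟨ cong (λ a → 1 ∸ bit (F n) a) (m≤n⇒m⊓n≡m v≤2^n) ⟩
    1 ∸ bit (F n) v                 ≡⟨ cong (1 ∸_) v∉F ⟩
    1                               ∎
    where open ≡-Reasoning
  n<s : n < s
  n<s = ≤-trans (≤-reflexive (sym (length-↾ x′ (suc n)))) (length≤⌜⌝ (x′ ↾ suc n))
  violated : ¬ traceCode F s ≡ 0
  violated s-closed
    with subst₂ _≤_ violation≡1 s-closed (term≤sumBelow (λ i → violation F i (iterate tl s i)) n<s)
  ... | ()

postcompose : Code → Real → Code → Functional
postcompose c y e = functional y (comp c (proj 0 ∷ e ∷ []))

postcompose-computes : ∀ {ψ y e f} {x : Real} (ψc : Computable₂ λ _ → ψ) →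
                       (∀ n → Eval (y ⊕ f) e [ n ] (x n)) →
                       (λ m → ψ m (x m)) ≐ postcompose (proj₁ ψc) y e [ f ]
postcompose-computes {y = y} {f = f} {x} ψc e⇓ m =
  ecomp (econs eproj (econs (e⇓ m) enil)) (proj₂ ψc (y ⊕ f) (m ∷ x m ∷ []))

postcompose-bounded : ∀ {ψ h y e} (ψc : Computable₂ λ _ → ψ) → (∀ m w → ψ m w ≤ h m) →
                      Bounded h (postcompose (proj₁ ψc) y e)
postcompose-bounded {ψ} {h} {y} ψc ψ≤h z m v (ecomp (econs eproj (econs {y = w} _ enil)) ψ⇓) =
  subst (_≤ h m) (Eval-deterministic (proj₂ ψc (y ⊕ z) (m ∷ w ∷ [])) ψ⇓) (ψ≤h m w)

truncation∈A : ∀ {I A h x} → TuringIdeal I → (∀ g → A g ⇔ B⟨ I ⟩ A g) → Computable₁ (λ _ → h) →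
               I⟨ I ⟩ A x → A (λ m → x m ⊓ h m)
truncation∈A {h = h} {x} ideal A⇔BA hc (y , y∈I , f , f∈A , e , e⇓) =
  Equivalence.from (A⇔BA _)
    ( postcompose (proj₁ truncate) y e
    , (y∈I , h , computable∈ideal ideal hc , postcompose-bounded {ψ} truncate (λ m w → m⊓n≤n w (h m)))
    , f , f∈A , postcompose-computes {ψ} {x = x} truncate e⇓ )
  where
  ψ : ℕ → ℕ → ℕ
  ψ m w = w ⊓ h m
  truncate : Computable₂ λ _ → ψ
  truncate = compose₂ ⊓-computable (proj-computable (# 1)) (compose₁ hc (proj-computable (# 0)))

lemma2p35 : (I : RealSet) → TuringIdeal I → (A : RealSet) →
            (∀ g → A g ⇔ B⟨ I ⟩ A g) → LaverProperty I A →
            ∀ x → I⟨ I ⟩ A x → ¬ WeaklyGeneric I x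
lemma2p35 I ideal A A⇔BA laver x x∈IA x-generic
  with laver _ (truncation∈A ideal A⇔BA 2^-computable x∈IA)
... | F , F∈I , F-trace , F-traces =
  x-generic (traceCode F) traceCode∈I (traceCode-nowhereDense F-trace) (traceCode-closed F-traces)
  where
  traceCode∈I : I (traceCode F)
  traceCode∈I = TuringIdeal.downward ideal (traceCode F) F F∈I (computable⇒≤T traceCode-computable F)
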